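{- Let $G=(V,E)$ be a directed graph, let $d_{\min}$ be the minimum indegree of the vertices of $G$, and let $V_f\subseteq V$ be a feedback vertex set of $G$. Then $|V_f|\ge d_{\min}$.
   Context: Graphs are finite and simple. A feedback vertex set of a directed graph $G=(V,E)$ is a set $V_f\subseteq V$ such that the subgraph of $G$ induced by $V\setminus V_f$ contains no directed cycle. -}

module Defs where

open import Data.Nat using (ℕ; suc; _⊓_; _≤_)
open import Data.Fin using (Fin)
open import Data.Fin.Subset using (Subset; _∈_; _∉_; ∣_∣)
open import Data.List using (List; []; _∷_; length)
open import Data.List.Relation.Unary.All using (All)
open import Data.List.Relation.Unary.Unique.Propositional using (Unique)
open import Data.Vec using (Vec; tabulate; foldr₁)
open import Data.Product using (Σ; _×_)
open import Relation.Nullary using (¬_; Dec)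
open import Relation.Nullary.Decidable using (⌊_⌋)
open import Relation.Binary.PropositionalEquality using (_≡_)

-- A finite simple directed graph on vertex set Fin n:
-- an edge relation u ⟶ v (edge from u to v), decidable, with no loops.
-- (Simple: at most one edge per ordered pair, automatic for a relation.)
record Digraph (n : ℕ) : Set₁ where
  field
    Edge     : Fin n → Fin n → Set
    edge?    : ∀ u v → Dec (Edge u v)
    loopless : ∀ v → ¬ Edge v v

open Digraph public

inNbrs : ∀ {n} → Digraph n → Fin n → Subset n
inNbrs G v = tabulate (λ u → ⌊ edge? G u v ⌋)

indegree : ∀ {n} → Digraph n → Fin n → ℕ
indegree G v = ∣ inNbrs G v ∣

minIndegree : ∀ {m} → Digraph (suc m) → ℕ
minIndegree G = foldr₁ _⊓_ (tabulate (indegree G))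

data PathTo {n} (G : Digraph n) (first : Fin n) : List (Fin n) → Set where
  close : ∀ {v} → Edge G v first → PathTo G first (v ∷ [])
  step  : ∀ {u v vs} → Edge G u v → PathTo G first (v ∷ vs) → PathTo G first (u ∷ v ∷ vs)

record DirectedCycle {n} (G : Digraph n) (vs : List (Fin n)) : Set where
  field
    start    : Fin n
    rest     : List (Fin n)
    shape    : vs ≡ start ∷ rest
    nonTriv  : 1 ≤ length rest
    distinct : Unique vs
    edges    : PathTo G start vs

-- V_f is a feedback vertex set: the subgraph induced by V ∖ V_f has no directed cycle,
-- i.e. no directed cycle of G lies entirely in V ∖ V_f.
IsFeedbackVertexSet : ∀ {n} → Digraph n → Subset n → Set
IsFeedbackVertexSet {n} G Vf =
  ∀ (vs : List (Fin n)) → All (λ v → v ∉ Vf) vs → ¬ DirectedCycle G vs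

module Submission where

-- If ∣ V_f ∣ were smaller than the minimum indegree, every vertex would have an
-- in-neighbour outside V_f. Walking backwards along such in-neighbours inside
-- V ∖ V_f must repeat a vertex after at most ∣ V ∣ steps, and the stretch of the
-- walk between the two visits is a directed cycle avoiding V_f.

open import Defs
open import Data.Nat using (ℕ; suc; zero; _+_; _≤_; _<_; _⊓_; z≤n; s≤s; _≤?_)
open import Data.Nat.Properties
  using (≤-refl; ≤-trans; ≤-reflexive; <-≤-trans; m⊓n≤m; m⊓n≤n; <⇒≱; ≰⇒>; +-suc; m<m+n)
open import Data.Fin using (Fin; zero; suc)
open import Data.Fin.Properties using (any?; injective⇒≤) renaming (_≟_ to _≟ᶠ_)
open import Data.Fin.Subset using (Subset; ∣_∣; _∈_; _∉_; _⊆_)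
open import Data.Fin.Subset.Properties using (_∈?_; p⊆q⇒∣p∣≤∣q∣)
open import Data.Vec using (Vec; _∷_; []; tabulate; foldr₁; lookup)
open import Data.Vec.Properties using (lookup∘tabulate; []=⇒lookup)
open import Data.List as List using (List; []; _∷_; length; take)
open import Data.List.Relation.Unary.All as All using (All; []; _∷_)
import Data.List.Relation.Unary.All.Properties as Allₚ
open import Data.List.Relation.Unary.Any using (here; there)
open import Data.List.Relation.Unary.AllPairs using ([]; _∷_)
open import Data.List.Relation.Unary.Unique.Propositional using (Unique)
import Data.List.Relation.Unary.Unique.Propositional.Properties as Unique
import Data.List.Membership.Propositional as Listₘ
open import Data.List.Membership.Propositional.Properties using (∈-lookup)
open import Data.Product using (∃-syntax; _×_; _,_)
open import Data.Empty using (⊥-elim)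
open import Relation.Nullary using (yes; no; ¬?)
open import Relation.Nullary.Decidable using (_×-dec_)
open import Relation.Unary using (Pred)
open import Level using (0ℓ)
open import Relation.Binary.PropositionalEquality using (_≡_; refl; sym; trans; cong)

foldr₁-⊓-≤-lookup : ∀ {k} (xs : Vec ℕ (suc k)) (i : Fin (suc k)) → foldr₁ _⊓_ xs ≤ lookup xs i
foldr₁-⊓-≤-lookup (x ∷ [])     zero    = ≤-refl
foldr₁-⊓-≤-lookup (x ∷ y ∷ ys) zero    = m⊓n≤m x _
foldr₁-⊓-≤-lookup (x ∷ y ∷ ys) (suc i) = ≤-trans (m⊓n≤n x _) (foldr₁-⊓-≤-lookup (y ∷ ys) i)

minIndegree≤indegree : ∀ {m} (G : Digraph (suc m)) v → minIndegree G ≤ indegree G v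
minIndegree≤indegree G v =
  ≤-trans (foldr₁-⊓-≤-lookup (tabulate (indegree G)) v) (≤-reflexive (lookup∘tabulate (indegree G) v))

∈inNbrs⇒Edge : ∀ {n} (G : Digraph n) {u v} → u ∈ inNbrs G v → Edge G u v
∈inNbrs⇒Edge G {u} {v} u∈ with edge? G u v | trans (sym ([]=⇒lookup u∈)) (lookup∘tabulate _ u)
... | yes e | _ = e
... | no _  | ()

∣p∣<∣q∣⇒∃∈q∉p : ∀ {n} {p q : Subset n} → ∣ p ∣ < ∣ q ∣ → ∃[ x ] x ∈ q × x ∉ p
∣p∣<∣q∣⇒∃∈q∉p {p = p} {q} ∣p∣<∣q∣ with any? (λ x → (x ∈? q) ×-dec ¬? (x ∈? p))
... | yes witness = witness
... | no ∄x = ⊥-elim (<⇒≱ ∣p∣<∣q∣ (p⊆q⇒∣p∣≤∣q∣ q⊆p))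
  where
  q⊆p : q ⊆ p
  q⊆p {x} x∈q with x ∈? p
  ... | yes x∈p = x∈p
  ... | no  x∉p = ⊥-elim (∄x (x , x∈q , x∉p))

Unique⇒lookup-injective : ∀ {a} {A : Set a} {xs : List A} → Unique xs →
  ∀ {i j} → List.lookup xs i ≡ List.lookup xs j → i ≡ j
Unique⇒lookup-injective (_ ∷ _)    {zero}  {zero}  _  = refl
Unique⇒lookup-injective (x∉xs ∷ _) {zero}  {suc j} eq = ⊥-elim (All.lookup x∉xs (∈-lookup j) eq)
Unique⇒lookup-injective (x∉xs ∷ _) {suc i} {zero}  eq = ⊥-elim (All.lookup x∉xs (∈-lookup i) (sym eq))
Unique⇒lookup-injective (_ ∷ xs!)  {suc i} {suc j} eq = cong suc (Unique⇒lookup-injective xs! eq)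

Unique⇒length≤ : ∀ {n} {xs : List (Fin n)} → Unique xs → length xs ≤ n
Unique⇒length≤ xs! = injective⇒≤ (Unique⇒lookup-injective xs!)

module _ {n} (G : Digraph n) where

  open import Data.List.Membership.DecPropositional (_≟ᶠ_ {n}) using () renaming (_∈?_ to _∈ˡ?_)

  data Walk : List (Fin n) → Set where
    [_] : ∀ v → Walk (v ∷ [])
    _∷_ : ∀ {u v vs} → Edge G u v → Walk (v ∷ vs) → Walk (u ∷ v ∷ vs)

  Walk⇒PathTo-take : ∀ {x xs u b} → Walk (x ∷ xs) → u Listₘ.∈ x ∷ xs → Edge G u b →
    ∃[ k ] PathTo G b (x ∷ take k xs)
  Walk⇒PathTo-take _        (here refl) u⟶b = 0 , close u⟶b
  Walk⇒PathTo-take (e ∷ w) (there u∈)  u⟶b with Walk⇒PathTo-take w u∈ u⟶b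
  ... | k , path = suc k , step e path

  Walk-closing⇒DirectedCycle : ∀ {P : Pred (Fin n) 0ℓ} {x xs u} →
    Walk (x ∷ xs) → Unique (x ∷ xs) → All P (x ∷ xs) → u Listₘ.∈ xs → Edge G u x →
    ∃[ vs ] All P vs × DirectedCycle G vs
  Walk-closing⇒DirectedCycle {x = x} {y ∷ ys} (e ∷ w) xs! Pxs u∈xs u⟶x
    with Walk⇒PathTo-take w u∈xs u⟶x
  ... | k , path = x ∷ y ∷ take k ys , Allₚ.take⁺ (2 + k) Pxs , record
    { start = x ; rest = y ∷ take k ys ; shape = refl ; nonTriv = s≤s z≤n
    ; distinct = Unique.take⁺ (2 + k) xs! ; edges = step e path }

  HasPredecessorIn : Pred (Fin n) 0ℓ → Set
  HasPredecessorIn P = ∀ {v} → P v → ∃[ u ] Edge G u v × P u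

  module _ {P : Pred (Fin n) 0ℓ} (hasPred : HasPredecessorIn P) where

    -- Fuel n suffices: a walk without repeated vertices has at most n vertices.
    extendBackwards : ∀ fuel {x xs} → n < fuel + length (x ∷ xs) →
      Walk (x ∷ xs) → Unique (x ∷ xs) → All P (x ∷ xs) →
      ∃[ vs ] All P vs × DirectedCycle G vs
    extendBackwards zero     bound _ xs! _ = ⊥-elim (<⇒≱ bound (Unique⇒length≤ xs!))
    extendBackwards (suc fuel) {x} {xs} bound w xs! (Px ∷ Pxs) with hasPred Px
    ... | u , u⟶x , Pu with u ∈ˡ? x ∷ xs
    ... | yes (here refl) = ⊥-elim (loopless G u u⟶x)
    ... | yes (there u∈xs) = Walk-closing⇒DirectedCycle w xs! (Px ∷ Pxs) u∈xs u⟶x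
    ... | no u∉ = extendBackwards fuel
            (≤-trans bound (≤-reflexive (sym (+-suc fuel _))))
            (u⟶x ∷ w) (Allₚ.¬Any⇒All¬ _ u∉ ∷ xs!) (Pu ∷ Px ∷ Pxs)

    HasPredecessorIn⇒DirectedCycle : ∀ {x} → P x → ∃[ vs ] All P vs × DirectedCycle G vs
    HasPredecessorIn⇒DirectedCycle {x} Px =
      extendBackwards n (m<m+n n (s≤s z≤n)) [ x ] ([] ∷ []) (Px ∷ [])

∣Vf∣<minIndegree⇒∃inNbr∉Vf : ∀ {m} (G : Digraph (suc m)) (Vf : Subset (suc m)) →
  ∣ Vf ∣ < minIndegree G → ∀ v → ∃[ u ] Edge G u v × u ∉ Vf
∣Vf∣<minIndegree⇒∃inNbr∉Vf G Vf ∣Vf∣<dmin v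
  with ∣p∣<∣q∣⇒∃∈q∉p (<-≤-trans ∣Vf∣<dmin (minIndegree≤indegree G v))
... | u , u∈inNbrs , u∉Vf = u , ∈inNbrs⇒Edge G u∈inNbrs , u∉Vf

mainTheorem4 : ∀ {m} (G : Digraph (suc m)) (Vf : Subset (suc m)) →
    IsFeedbackVertexSet G Vf → minIndegree G ≤ ∣ Vf ∣
mainTheorem4 G Vf fvs with minIndegree G ≤? ∣ Vf ∣
... | yes dmin≤∣Vf∣ = dmin≤∣Vf∣
... | no dmin≰∣Vf∣ =
  let inNbr∉Vf = ∣Vf∣<minIndegree⇒∃inNbr∉Vf G Vf (≰⇒> dmin≰∣Vf∣)
      _ , _ , start∉Vf = inNbr∉Vf zero
      vs , avoidsVf , cycle = HasPredecessorIn⇒DirectedCycle G (λ {v} _ → inNbr∉Vf v) start∉Vf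
  in ⊥-elim (fvs vs avoidsVf cycle)
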